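{- Let $n\ge1$ and $0\le j\le n$, and let $\omega\in\mathcal{B}_j(n,n)$. Then (i) $\gamma(\omega)\in\mathcal{F}_{2j}(2n,2n)$ and $\mathrm{sump}(\gamma(\omega))=2\,\mathrm{sump}(\omega)$; (ii) $|\mathcal{F}_{2j}(2n,2n)|=|\mathcal{B}_j(n,n)|$ and $|\mathcal{F}_{2j+1}(2n,2n)|=0$; (iii) $\mathcal{F}(2n,2n)$ consists exactly of the paths in $\mathcal{B}(2n,2n)$ that have no odd peaks and no odd valleys.
   Context: Lattice paths start at $(0,0)$ and use steps $\mathsf N=(0,1)$, $\mathsf E=(1,0)$. $\mathcal{B}(a,b)$ is the set of all such paths from $(0,0)$ to $(b,a)$ (i.e. $a$ north steps and $b$ east steps); $\mathcal{B}_j(a,b)$ is the subset of paths passing through $(0,j)$ and $(1,j)$ (i.e. beginning with $\mathsf N^j\mathsf E$). A peak is an occurrence of consecutive steps $\mathsf N\mathsf E$ and a valley an occurrence of $\mathsf E\mathsf N$, each identified with the lattice point between the two steps; a lattice point $(x,y)$ is odd if $x+y$ is odd. $\mathrm{sump}$ of a path is the sum of the $x$- and $y$-coordinates of all its peaks. For $\omega\in\mathcal{B}(n,n)$, $\gamma(\omega)\in\mathcal{B}(2n,2n)$ is the path obtained by duplicating every step of $\omega$. $\mathcal{F}(2n,2n)=\{\gamma(\omega):\omega\in\mathcal{B}(n,n)\}$ and $\mathcal{F}_i(2n,2n)=\mathcal{F}(2n,2n)\cap\mathcal{B}_i(2n,2n)$. -}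

module Defs where

open import Data.Nat using (ℕ; zero; suc; _+_; _*_; _%_)
open import Data.List using (List; []; _∷_; _++_; replicate; concatMap)
open import Data.Product using (Σ; ∃; ∃-syntax; _×_; _,_)
open import Relation.Binary.PropositionalEquality using (_≡_)

-- Steps: N = (0,1), E = (1,0).  A path is the list of its steps, starting at (0,0).
data Step : Set where
  N E : Step

countN : List Step → ℕ
countN []       = 0
countN (N ∷ w)  = suc (countN w)
countN (E ∷ w)  = countN w

countE : List Step → ℕ
countE []       = 0
countE (N ∷ w)  = countE w
countE (E ∷ w)  = suc (countE w)

-- w ∈ 𝓑(a,b): a north steps and b east steps (path from (0,0) to (b,a)).
InB : ℕ → ℕ → List Step → Set
InB a b w = countN w ≡ a × countE w ≡ b

InBj : ℕ → ℕ → ℕ → List Step → Set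
InBj j a b w = InB a b w × (∃[ rest ] (w ≡ replicate j N ++ (E ∷ rest)))

γ : List Step → List Step
γ = concatMap (λ s → s ∷ s ∷ [])

InF : ℕ → List Step → Set
InF n w = ∃[ ω ] (InB n n ω × w ≡ γ ω)

InFi : ℕ → ℕ → List Step → Set
InFi i n w = InF n w × InBj i (2 * n) (2 * n) w

IsPeak : List Step → ℕ → ℕ → Set
IsPeak w x y = ∃[ u ] ∃[ v ] (w ≡ u ++ (N ∷ E ∷ v) × x ≡ countE u × y ≡ suc (countN u))

IsValley : List Step → ℕ → ℕ → Set
IsValley w x y = ∃[ u ] ∃[ v ] (w ≡ u ++ (E ∷ N ∷ v) × x ≡ suc (countE u) × y ≡ countN u)

OddPoint : ℕ → ℕ → Set
OddPoint x y = (x + y) % 2 ≡ 1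

HasOddPeak : List Step → Set
HasOddPeak w = ∃[ x ] ∃[ y ] (IsPeak w x y × OddPoint x y)

HasOddValley : List Step → Set
HasOddValley w = ∃[ x ] ∃[ y ] (IsValley w x y × OddPoint x y)

-- sump: sum of x + y over all peaks (x,y); sumpFrom x y w walks w from current point (x,y).
sumpFrom : ℕ → ℕ → List Step → ℕ
sumpFrom x y []            = 0
sumpFrom x y (N ∷ E ∷ w)   = (x + suc y) + sumpFrom x (suc y) (E ∷ w)
sumpFrom x y (N ∷ [])      = 0
sumpFrom x y (N ∷ N ∷ w)   = sumpFrom x (suc y) (N ∷ w)
sumpFrom x y (E ∷ w)       = sumpFrom (suc x) y w

sump : List Step → ℕ
sump = sumpFrom 0 0

-- Duplicating every step scales every lattice point of a path by 2, so the peaks of γ ω are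
-- the doubled peaks of ω (whence sump doubles) and N^j E becomes N^2j E E. Peaks and valleys of
-- γ ω, and more generally all its turning points, lie between the two copies of a step and
-- hence have even coordinate sum. Conversely, a path of even length without odd turning points
-- is a sequence of pairs of equal steps, i.e. lies in the image of γ. Since γ is injective and
-- membership in 𝓑_j(a,b) is proof-irrelevant, γ is a bijection 𝓑_j(n,n) → 𝓕_2j(2n,2n).
module Submission where

open import Defs
open import Axiom.UniquenessOfIdentityProofs.WithK using (uip)
open import Data.Nat using (ℕ; zero; suc; _+_; _*_; _≤_; _%_)
open import Data.Nat.Properties
  using (+-suc; +-identityʳ; *-suc; *-comm; *-distribˡ-+; *-cancelˡ-≡; ≡-irrelevant; even≢odd)
open import Data.Nat.DivMod using (m*n%n≡0)
open import Data.List using (List; []; _∷_; _++_; replicate; length)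
open import Data.List.Properties using (∷-injectiveʳ; ++-cancelˡ)
open import Data.Product using (Σ; _×_; _,_; ∃-syntax; map)
open import Function using (_∘_)
open import Function.Bundles using (_⤖_; mk↔ₛ′)
open import Function.Properties.Inverse using (↔⇒⤖)
open import Relation.Binary.PropositionalEquality
  using (_≡_; _≢_; refl; sym; trans; cong; cong₂; subst; module ≡-Reasoning)
open import Relation.Nullary using (¬_; contradiction)
open import Relation.Nullary.Irrelevant using (Irrelevant)

-- (2 + m) % 2 reduces to m % 2, so Odd (2 + m) and Odd m are definitionally equal.
Odd : ℕ → Set
Odd m = m % 2 ≡ 1

¬Odd-2* : ∀ k → ¬ Odd (2 * k)
¬Odd-2* k odd with trans (sym (trans (cong (_% 2) (*-comm 2 k)) (m*n%n≡0 k 2))) odd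
... | ()

countE+countN≡length : ∀ w → countE w + countN w ≡ length w
countE+countN≡length []      = refl
countE+countN≡length (N ∷ w) = trans (+-suc (countE w) (countN w)) (cong suc (countE+countN≡length w))
countE+countN≡length (E ∷ w) = cong suc (countE+countN≡length w)

InB-¬Odd-length : ∀ n w → InB (2 * n) (2 * n) w → ¬ Odd (length w)
InB-¬Odd-length n w (#N , #E) = ¬Odd-2* (2 * n) ∘ subst Odd (begin
  length w              ≡⟨ sym (countE+countN≡length w) ⟩
  countE w + countN w   ≡⟨ cong₂ _+_ #E #N ⟩
  2 * n + 2 * n         ≡⟨ cong (2 * n +_) (sym (+-identityʳ (2 * n))) ⟩
  2 * (2 * n)           ∎)
  where open ≡-Reasoning

countN-γ : ∀ ω → countN (γ ω) ≡ 2 * countN ω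
countN-γ []      = refl
countN-γ (N ∷ ω) = trans (cong (2 +_) (countN-γ ω)) (sym (*-suc 2 (countN ω)))
countN-γ (E ∷ ω) = countN-γ ω

countE-γ : ∀ ω → countE (γ ω) ≡ 2 * countE ω
countE-γ []      = refl
countE-γ (N ∷ ω) = countE-γ ω
countE-γ (E ∷ ω) = trans (cong (2 +_) (countE-γ ω)) (sym (*-suc 2 (countE ω)))

γ-InB : ∀ {a b} ω → InB a b ω → InB (2 * a) (2 * b) (γ ω)
γ-InB ω (#N , #E) = trans (countN-γ ω) (cong (2 *_) #N) , trans (countE-γ ω) (cong (2 *_) #E)

γ-InB⁻¹ : ∀ {a b} ω → InB (2 * a) (2 * b) (γ ω) → InB a b ω
γ-InB⁻¹ ω (#N , #E) =
  *-cancelˡ-≡ _ _ 2 (trans (sym (countN-γ ω)) #N) , *-cancelˡ-≡ _ _ 2 (trans (sym (countE-γ ω)) #E)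

InB-irrelevant : ∀ {a b} w → Irrelevant (InB a b w)
InB-irrelevant _ (p , q) (p′ , q′) = cong₂ _,_ (≡-irrelevant p p′) (≡-irrelevant q q′)

StartsWith : ℕ → List Step → Set
StartsWith j w = ∃[ rest ] w ≡ replicate j N ++ E ∷ rest

StartsWith-irrelevant : ∀ j w → Irrelevant (StartsWith j w)
StartsWith-irrelevant j _ (rest , p) (rest′ , p′)
  with ∷-injectiveʳ (++-cancelˡ (replicate j N) _ _ (trans (sym p) p′))
... | refl = cong (rest ,_) (uip p p′)

InBj-irrelevant : ∀ {a b} j w → Irrelevant (InBj j a b w)
InBj-irrelevant j w (p , s) (p′ , s′) = cong₂ _,_ (InB-irrelevant w p p′) (StartsWith-irrelevant j w s s′)

γ-StartsWith : ∀ j ω → StartsWith j ω → StartsWith (2 * j) (γ ω)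
γ-StartsWith zero    _ (rest , refl) = E ∷ γ rest , refl
γ-StartsWith (suc j) _ (rest , refl) with γ-StartsWith j _ (rest , refl)
... | rest′ , eq =
  rest′ , trans (cong (λ w → N ∷ N ∷ w) eq) (cong (λ m → replicate m N ++ E ∷ rest′) (sym (*-suc 2 j)))

γ-StartsWith⁻¹ : ∀ ω i → StartsWith i (γ ω) → ∃[ j ] (i ≡ 2 * j × StartsWith j ω)
γ-StartsWith⁻¹ []      zero          (_ , ())
γ-StartsWith⁻¹ []      (suc i)       (_ , ())
γ-StartsWith⁻¹ (N ∷ ω) zero          (_ , ())
γ-StartsWith⁻¹ (E ∷ ω) zero          _ = 0 , refl , ω , refl
γ-StartsWith⁻¹ (E ∷ ω) (suc i)       (_ , ())
γ-StartsWith⁻¹ (N ∷ ω) (suc zero)    (_ , ())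
γ-StartsWith⁻¹ (N ∷ ω) (suc (suc i)) (rest , eq)
  with γ-StartsWith⁻¹ ω i (rest , ∷-injectiveʳ (∷-injectiveʳ eq))
... | j , refl , r , refl = suc j , sym (*-suc 2 j) , r , refl

γ-StartsWith-2*⁻¹ : ∀ j ω → StartsWith (2 * j) (γ ω) → StartsWith j ω
γ-StartsWith-2*⁻¹ j ω s with γ-StartsWith⁻¹ ω (2 * j) s
... | j′ , 2j≡2j′ , s′ rewrite *-cancelˡ-≡ j j′ 2 2j≡2j′ = s′

¬γ-StartsWith-odd : ∀ j ω → ¬ StartsWith (suc (2 * j)) (γ ω)
¬γ-StartsWith-odd j ω s with γ-StartsWith⁻¹ ω (suc (2 * j)) s
... | j′ , 1+2j≡2j′ , _ = even≢odd j′ j (sym 1+2j≡2j′)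

γ-InBj : ∀ {a b} j ω → InBj j a b ω → InBj (2 * j) (2 * a) (2 * b) (γ ω)
γ-InBj j ω (p , s) = γ-InB ω p , γ-StartsWith j ω s

sumpFrom-γ : ∀ ω x y → sumpFrom (2 * x) (2 * y) (γ ω) ≡ 2 * sumpFrom x y ω
sumpFrom-γ []          x y = refl
sumpFrom-γ (N ∷ [])    x y = refl
sumpFrom-γ (N ∷ N ∷ ω) x y =
  trans (cong (λ y′ → sumpFrom (2 * x) y′ (γ (N ∷ ω))) (sym (*-suc 2 y))) (sumpFrom-γ (N ∷ ω) x (suc y))
sumpFrom-γ (N ∷ E ∷ ω) x y = begin
  2 * x + (2 + 2 * y) + sumpFrom (2 + 2 * x) (2 + 2 * y) (γ ω)
    ≡⟨ cong₂ (λ x′ y′ → 2 * x + y′ + sumpFrom x′ y′ (γ ω)) (sym (*-suc 2 x)) (sym (*-suc 2 y)) ⟩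
  2 * x + 2 * suc y + sumpFrom (2 * suc x) (2 * suc y) (γ ω)
    ≡⟨ cong (2 * x + 2 * suc y +_) (sumpFrom-γ ω (suc x) (suc y)) ⟩
  2 * x + 2 * suc y + 2 * sumpFrom (suc x) (suc y) ω
    ≡⟨ cong (_+ 2 * sumpFrom (suc x) (suc y) ω) (sym (*-distribˡ-+ 2 x (suc y))) ⟩
  2 * (x + suc y) + 2 * sumpFrom (suc x) (suc y) ω
    ≡⟨ sym (*-distribˡ-+ 2 (x + suc y) _) ⟩
  2 * (x + suc y + sumpFrom (suc x) (suc y) ω) ∎
  where open ≡-Reasoning
sumpFrom-γ (E ∷ ω)     x y =
  trans (cong (λ x′ → sumpFrom x′ (2 * y) (γ ω)) (sym (*-suc 2 x))) (sumpFrom-γ ω (suc x) y)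

sump-γ : ∀ ω → sump (γ ω) ≡ 2 * sump ω
sump-γ ω = sumpFrom-γ ω 0 0

-- The point between the steps a and b of w = u ++ a ∷ b ∷ v has coordinate sum suc (length u).
NoOddTurn : List Step → Set
NoOddTurn w = ∀ u {a b} v → a ≢ b → w ≡ u ++ a ∷ b ∷ v → ¬ Odd (suc (length u))

NoOddTurn-∷∷⁻ : ∀ {s t w} → NoOddTurn (s ∷ t ∷ w) → NoOddTurn w
NoOddTurn-∷∷⁻ {s = s} {t} noOdd u v a≢b eq = noOdd (s ∷ t ∷ u) v a≢b (cong (λ w → s ∷ t ∷ w) eq)

γ-NoOddTurn : ∀ ω → NoOddTurn (γ ω)
γ-NoOddTurn []      []          _ _   ()
γ-NoOddTurn []      (_ ∷ _)     _ _   ()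
γ-NoOddTurn (s ∷ ω) []          _ a≢b refl = contradiction refl a≢b
γ-NoOddTurn (s ∷ ω) (_ ∷ [])    _ _   _    = λ ()
γ-NoOddTurn (s ∷ ω) (_ ∷ _ ∷ u) v a≢b eq   = γ-NoOddTurn ω u v a≢b (∷-injectiveʳ (∷-injectiveʳ eq))

NoOddTurn⇒γ : ∀ w → ¬ Odd (length w) → NoOddTurn w → ∃[ ω ] w ≡ γ ω
NoOddTurn⇒γ []          _    _     = [] , refl
NoOddTurn⇒γ (_ ∷ [])    even _     = contradiction refl even
NoOddTurn⇒γ (N ∷ E ∷ w) _    noOdd = contradiction refl (noOdd [] w (λ ()) refl)
NoOddTurn⇒γ (E ∷ N ∷ w) _    noOdd = contradiction refl (noOdd [] w (λ ()) refl)
NoOddTurn⇒γ (N ∷ N ∷ w) even noOdd =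
  map (N ∷_) (cong (λ w′ → N ∷ N ∷ w′)) (NoOddTurn⇒γ w even (NoOddTurn-∷∷⁻ noOdd))
NoOddTurn⇒γ (E ∷ E ∷ w) even noOdd =
  map (E ∷_) (cong (λ w′ → E ∷ E ∷ w′)) (NoOddTurn⇒γ w even (NoOddTurn-∷∷⁻ noOdd))

peak-sum : ∀ u → countE u + suc (countN u) ≡ suc (length u)
peak-sum u = trans (+-suc (countE u) (countN u)) (cong suc (countE+countN≡length u))

valley-sum : ∀ u → suc (countE u) + countN u ≡ suc (length u)
valley-sum u = cong suc (countE+countN≡length u)

NoOddTurn⇒¬HasOddPeak : ∀ {w} → NoOddTurn w → ¬ HasOddPeak w
NoOddTurn⇒¬HasOddPeak noOdd (_ , _ , (u , v , eq , refl , refl) , odd) =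
  noOdd u v (λ ()) eq (subst Odd (peak-sum u) odd)

NoOddTurn⇒¬HasOddValley : ∀ {w} → NoOddTurn w → ¬ HasOddValley w
NoOddTurn⇒¬HasOddValley noOdd (_ , _ , (u , v , eq , refl , refl) , odd) =
  noOdd u v (λ ()) eq (subst Odd (valley-sum u) odd)

¬HasOddPeak×¬HasOddValley⇒NoOddTurn : ∀ {w} → ¬ HasOddPeak w → ¬ HasOddValley w → NoOddTurn w
¬HasOddPeak×¬HasOddValley⇒NoOddTurn _      _        u {N} {N} _ N≢N _  = contradiction refl N≢N
¬HasOddPeak×¬HasOddValley⇒NoOddTurn _      _        u {E} {E} _ E≢E _  = contradiction refl E≢E
¬HasOddPeak×¬HasOddValley⇒NoOddTurn noPeak _        u {N} {E} v _   eq =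
  λ odd → noPeak (_ , _ , (u , v , eq , refl , refl) , subst Odd (sym (peak-sum u)) odd)
¬HasOddPeak×¬HasOddValley⇒NoOddTurn _      noValley u {E} {N} v _   eq =
  λ odd → noValley (_ , _ , (u , v , eq , refl , refl) , subst Odd (sym (valley-sum u)) odd)

γ-InFi : ∀ n j ω → InBj j n n ω → InFi (2 * j) n (γ ω)
γ-InFi n j ω q@(p , _) = (ω , p , refl) , γ-InBj j ω q

γ-InFi-bijection : ∀ n j → Σ (List Step) (InFi (2 * j) n) ⤖ Σ (List Step) (InBj j n n)
γ-InFi-bijection n j = ↔⇒⤖ (mk↔ₛ′ to from to∘from from∘to)
  where
  to : Σ (List Step) (InFi (2 * j) n) → Σ (List Step) (InBj j n n)
  to (_ , (ω , p , refl) , _ , s) = ω , p , γ-StartsWith-2*⁻¹ j ω s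

  from : Σ (List Step) (InBj j n n) → Σ (List Step) (InFi (2 * j) n)
  from (ω , p) = γ ω , γ-InFi n j ω p

  to∘from : ∀ x → to (from x) ≡ x
  to∘from (ω , p) = cong (ω ,_) (InBj-irrelevant j ω _ _)

  from∘to : ∀ y → from (to y) ≡ y
  from∘to (_ , (ω , p , refl) , q) =
    cong (λ q′ → γ ω , (ω , p , refl) , q′) (InBj-irrelevant (2 * j) (γ ω) _ _)

¬InFi-odd : ∀ n j → ¬ Σ (List Step) (InFi (suc (2 * j)) n)
¬InFi-odd n j (_ , (ω , _ , refl) , _ , s) = ¬γ-StartsWith-odd j ω s

InF⇒InB×¬HasOddPeak×¬HasOddValley :
  ∀ n w → InF n w → InB (2 * n) (2 * n) w × ¬ HasOddPeak w × ¬ HasOddValley w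
InF⇒InB×¬HasOddPeak×¬HasOddValley n _ (ω , p , refl) =
  γ-InB ω p , NoOddTurn⇒¬HasOddPeak (γ-NoOddTurn ω) , NoOddTurn⇒¬HasOddValley (γ-NoOddTurn ω)

InB×¬HasOddPeak×¬HasOddValley⇒InF :
  ∀ n w → InB (2 * n) (2 * n) w × ¬ HasOddPeak w × ¬ HasOddValley w → InF n w
InB×¬HasOddPeak×¬HasOddValley⇒InF n w (p , noPeak , noValley)
  with NoOddTurn⇒γ w (InB-¬Odd-length n w p) (¬HasOddPeak×¬HasOddValley⇒NoOddTurn noPeak noValley)
... | ω , refl = ω , γ-InB⁻¹ ω p , refl

lemma4p2 : (n : ℕ) → 1 ≤ n →
    ((j : ℕ) → j ≤ n →
      ((ω : List Step) → InBj j n n ω →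
          InFi (2 * j) n (γ ω) × sump (γ ω) ≡ 2 * sump ω)
      × (Σ (List Step) (InFi (2 * j) n) ⤖ Σ (List Step) (InBj j n n))
      × ¬ Σ (List Step) (InFi (suc (2 * j)) n))
    × ((w : List Step) →
        (InF n w → InB (2 * n) (2 * n) w × ¬ HasOddPeak w × ¬ HasOddValley w)
        × (InB (2 * n) (2 * n) w × ¬ HasOddPeak w × ¬ HasOddValley w → InF n w))
lemma4p2 n _ =
  (λ j _ → (λ ω p → γ-InFi n j ω p , sump-γ ω) , γ-InFi-bijection n j , ¬InFi-odd n j) ,
  (λ w → InF⇒InB×¬HasOddPeak×¬HasOddValley n w , InB×¬HasOddPeak×¬HasOddValley⇒InF n w)
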